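{- Let $(\Omega,S)$ be a regular thin Jordan scheme, fix $\omega_0\in\Omega$, let $\diamond$ be the operation on $S$ defined by $a\diamond b=$ the unique $c\in S$ with $c(\omega_0)=a(b(\omega_0))$, and for $a\in S$ let $\ell_a:S\to S$, $\ell_a(x)=a\diamond x$. Let $\sigma:S\to\Omega$, $\sigma(s)=s(\omega_0)$. Then (1) $\sigma$ is a bijection; (2) $\sigma^{ -1}\circ a\circ\sigma=\ell_a$ for each $a\in S$; (3) for all $u,v\in S$, the unique element of $S$ mapping $\sigma(u)$ to $\sigma(v)$ equals $v/u$, where $v/u$ denotes the unique $w\in S$ with $w\diamond u=v$; that is, $(\sigma,\sigma,\mathrm{id}_S)$ is an isotopism from the Latin square $(v/u)_{v,u\in S}$ to the Latin square $(S(\alpha,\beta))_{\alpha,\beta\in\Omega}$, where $S(\alpha,\beta)$ is the unique $s\in S$ with $s(\alpha)=\beta$.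
   Context: $\Omega$ is a finite nonempty set, $\mathbb{F}$ a field with $\mathrm{char}\,\mathbb{F}\neq2$, $A\star B=\tfrac12(AB+BA)$. A regular thin Jordan scheme $(\Omega,S)$ here means: $S$ is a set of permutations of $\Omega$, each regarded as the relation $\{(\omega,s(\omega))\}$, such that these relations partition $\Omega\times\Omega$, $1_\Omega\in S$, $s^{ -1}\in S$ for every $s\in S$, and the $\mathbb{F}$-span of the permutation matrices of the elements of $S$ is closed under $\star$. $(S,\diamond)$ has unique right division (for all $a,b$ the equation $x\diamond a=b$ has a unique solution). -}

module Defs where

open import Level using (Level; _⊔_; suc)
open import Data.Nat using (ℕ; NonZero)
open import Data.Fin using (Fin; _≟_)
open import Data.Fin.Permutation using (Permutation′; _⟨$⟩ʳ_; _⟨$⟩ˡ_)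
open import Data.Product using (Σ; ∃; _×_; _,_; proj₁)
open import Relation.Nullary using (¬_; does)
open import Relation.Binary.PropositionalEquality using (_≡_)
open import Data.Bool using (if_then_else_)
open import Algebra.Bundles using (CommutativeRing)

record Field (c ℓ : Level) : Set (Level.suc (c ⊔ ℓ)) where
  field
    commutativeRing : CommutativeRing c ℓ
  open CommutativeRing commutativeRing public
  field
    0≉1     : ¬ (0# ≈ 1#)
    _⁻¹     : (x : Carrier) → ¬ (x ≈ 0#) → Carrier
    inverse : (x : Carrier) (x≉0 : ¬ (x ≈ 0#)) → x * (x ⁻¹) x≉0 ≈ 1#

CharNot2 : ∀ {c ℓ} → Field c ℓ → Set ℓ
CharNot2 F = ¬ (1# + 1# ≈ 0#) where open Field F

∃! : ∀ {a b} {A : Set a} → (A → Set b) → Set (a ⊔ b)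
∃! {A = A} P = Σ A λ x → P x × (∀ y → P y → y ≡ x)

module Matrices {c ℓ} (F : Field c ℓ) where
  open Field F

  Matrix : ℕ → Set c
  Matrix n = Fin n → Fin n → Carrier

  Σ[_] : ∀ k → (Fin k → Carrier) → Carrier
  Σ[ ℕ.zero ] f = 0#
  Σ[ ℕ.suc k ] f = f Fin.zero + Σ[ k ] (λ i → f (Fin.suc i))

  _·_ : ∀ {n} → Matrix n → Matrix n → Matrix n
  (A · B) i j = Σ[ _ ] (λ k → A i k * B k j)

  _⊕_ : ∀ {n} → Matrix n → Matrix n → Matrix n
  (A ⊕ B) i j = A i j + B i j

  _⊙_ : ∀ {n} → Carrier → Matrix n → Matrix n
  (a ⊙ A) i j = a * A i j

  _≋_ : ∀ {n} → Matrix n → Matrix n → Set ℓ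
  A ≋ B = ∀ i j → A i j ≈ B i j

  jordan : ∀ {n} → CharNot2 F → Matrix n → Matrix n → Matrix n
  jordan ch A B = ((1# + 1#) ⁻¹) ch ⊙ ((A · B) ⊕ (B · A))

  permMatrix : ∀ {n} → Permutation′ n → Matrix n
  permMatrix p α β = if does ((p ⟨$⟩ʳ α) ≟ β) then 1# else 0#

  lincomb : ∀ {n m} → (Fin m → Carrier) → (Fin m → Matrix n) → Matrix n
  lincomb {m = m} coef M α β = Σ[ m ] (λ i → coef i * M i α β)

  InSpan : ∀ {n m} → (Fin m → Matrix n) → Matrix n → Set (c ⊔ ℓ)
  InSpan {m = m} M A = Σ (Fin m → Carrier) λ coef → A ≋ lincomb coef M

-- A regular thin Jordan scheme on Ω = Fin n (n ≥ 1) over the field F;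
-- S is given as a family s : Fin m → Permutation′ n of permutations.
record RegularThinJordanScheme {c ℓ} (F : Field c ℓ) (ch : CharNot2 F)
                               (n m : ℕ) : Set (c ⊔ ℓ) where
  open Matrices F
  field
    s : Fin m → Permutation′ n
    -- the relations {(ω, s(ω))} partition Ω × Ω
    partition : ∀ (α β : Fin n) → ∃! λ i → s i ⟨$⟩ʳ α ≡ β
    identity : ∃ λ i → ∀ ω → s i ⟨$⟩ʳ ω ≡ ω
    inverses : ∀ i → ∃ λ j → ∀ ω → s j ⟨$⟩ʳ ω ≡ s i ⟨$⟩ˡ ω
    jordanClosed : ∀ A B → InSpan (λ i → permMatrix (s i)) A
                         → InSpan (λ i → permMatrix (s i)) B
                         → InSpan (λ i → permMatrix (s i)) (jordan ch A B)

  S⟨_,_⟩ : Fin n → Fin n → Fin m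
  S⟨ α , β ⟩ = proj₁ (partition α β)

  module AtBasePoint (ω₀ : Fin n) where
    _◇_ : Fin m → Fin m → Fin m
    a ◇ b = S⟨ ω₀ , s a ⟨$⟩ʳ (s b ⟨$⟩ʳ ω₀) ⟩

    ℓ[_] : Fin m → Fin m → Fin m
    ℓ[ a ] x = a ◇ x

    σ : Fin m → Fin n
    σ x = s x ⟨$⟩ʳ ω₀

-- Thinness makes S act regularly on Ω: for each ω there is exactly one s ∈ S with
-- s(ω₀) = ω, so σ is a bijection whose inverse is ω ↦ S(ω₀, ω). Transporting a ∈ S
-- along σ gives x ↦ S(ω₀, a(x(ω₀))) = a ◇ x by definition, and w ◇ u = v says
-- exactly that w maps σ u to σ v, i.e. w = S(σ u, σ v).
module Submission where

open import Defs
open import Data.Nat using (ℕ)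
open import Data.Fin using (Fin)
open import Data.Fin.Permutation using (_⟨$⟩ʳ_)
open import Data.Product using (Σ; _×_; _,_; proj₁; proj₂)
open import Relation.Binary.PropositionalEquality using (_≡_; refl; sym; trans; cong)

module SchemeProperties {c ℓ} {F : Field c ℓ} {ch : CharNot2 F} {n m : ℕ}
                        (𝒮 : RegularThinJordanScheme F ch n m) where
  open RegularThinJordanScheme 𝒮

  S⟨⟩-maps : ∀ α β → s S⟨ α , β ⟩ ⟨$⟩ʳ α ≡ β
  S⟨⟩-maps α β = proj₁ (proj₂ (partition α β))

  S⟨⟩-unique : ∀ α β i → s i ⟨$⟩ʳ α ≡ β → i ≡ S⟨ α , β ⟩
  S⟨⟩-unique α β = proj₂ (proj₂ (partition α β))

  S⟨⟩-of-image : ∀ α i → S⟨ α , s i ⟨$⟩ʳ α ⟩ ≡ i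
  S⟨⟩-of-image α i = sym (S⟨⟩-unique α _ i refl)

  module BasePointProperties (ω₀ : Fin n) where
    open AtBasePoint ω₀

    σ⁻¹ : Fin n → Fin m
    σ⁻¹ ω = S⟨ ω₀ , ω ⟩

    σ⁻¹∘σ : ∀ x → σ⁻¹ (σ x) ≡ x
    σ⁻¹∘σ = S⟨⟩-of-image ω₀

    σ∘σ⁻¹ : ∀ ω → σ (σ⁻¹ ω) ≡ ω
    σ∘σ⁻¹ = S⟨⟩-maps ω₀

    conjugation-is-ℓ : ∀ a x → σ⁻¹ (s a ⟨$⟩ʳ σ x) ≡ ℓ[ a ] x
    conjugation-is-ℓ a x = refl

    σ-injective : ∀ {x y} → σ x ≡ σ y → x ≡ y
    σ-injective {x} {y} eq = trans (sym (σ⁻¹∘σ x)) (trans (cong σ⁻¹ eq) (σ⁻¹∘σ y))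

    σ-◇ : ∀ a b → σ (a ◇ b) ≡ s a ⟨$⟩ʳ σ b
    σ-◇ a b = σ∘σ⁻¹ (s a ⟨$⟩ʳ σ b)

    ◇-divides : ∀ u v → S⟨ σ u , σ v ⟩ ◇ u ≡ v
    ◇-divides u v = σ-injective (trans (σ-◇ S⟨ σ u , σ v ⟩ u) (S⟨⟩-maps (σ u) (σ v)))

    ◇-division-unique : ∀ u v w → w ◇ u ≡ v → w ≡ S⟨ σ u , σ v ⟩
    ◇-division-unique u v w eq =
      S⟨⟩-unique (σ u) (σ v) w (trans (sym (σ-◇ w u)) (cong σ eq))

proposition3p8 : ∀ {c ℓ} (F : Field c ℓ) (ch : CharNot2 F) (n m : ℕ)
    (𝒮 : RegularThinJordanScheme F ch n m) (ω₀ : Fin n) →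
    let open RegularThinJordanScheme 𝒮
        open AtBasePoint ω₀
    in Σ (Fin n → Fin m) λ σ⁻¹ →
         ((∀ x → σ⁻¹ (σ x) ≡ x) × (∀ ω → σ (σ⁻¹ ω) ≡ ω))
       × (∀ a x → σ⁻¹ (s a ⟨$⟩ʳ σ x) ≡ ℓ[ a ] x)
       × (∀ u v → (S⟨ σ u , σ v ⟩ ◇ u ≡ v)
                × (∀ w → w ◇ u ≡ v → w ≡ S⟨ σ u , σ v ⟩))
proposition3p8 F ch n m 𝒮 ω₀ =
  σ⁻¹ , (σ⁻¹∘σ , σ∘σ⁻¹) , conjugation-is-ℓ ,
  (λ u v → ◇-divides u v , ◇-division-unique u v)
  where
  open SchemeProperties 𝒮
  open BasePointProperties ω₀
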